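{- Let $t>0$ be an integer and let $p$ be an odd prime. Let $b=2p^4$. If $\{1,b,c\}$ is a $D(-1)$-triple in the ring $\mathbb{Z}[\sqrt{ -t}]$, then $c\in \mathbb{Z}$.
   Context: For a positive integer $t$, $\mathbb{Z}[\sqrt{ -t}]=\{a+b\sqrt{ -t}: a,b\in\mathbb{Z}\}$. For a non-zero element $n$ of a commutative ring $R$, a $D(n)$-$m$-tuple (Diophantine $m$-tuple with the property $D(n)$) is a set of $m$ non-zero elements of $R$ such that for any two distinct elements $a,b$ of the set, $ab+n=k^2$ for some $k\in R$. A $D(-1)$-triple is the case $n=-1$, $m=3$. -}

module Defs where

open import Data.Nat using (ℕ)
open import Data.Integer using (ℤ; +_; _+_; _*_; -_; _-_; 0ℤ; 1ℤ)
open import Data.Nat.Primality using (Prime)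
open import Data.Product using (_×_; ∃; _,_)
open import Relation.Binary.PropositionalEquality using (_≡_)
open import Relation.Nullary using (¬_)

-- Elements a + b√(-t) of ℤ[√-t], represented by the pair (a , b).
-- Since t > 0, √(-t) is not rational, so this representation is unique.
record ℤ√- (t : ℕ) : Set where
  constructor _+_√-
  field
    re : ℤ
    im : ℤ
open ℤ√- public

_⊕_ : ∀ {t} → ℤ√- t → ℤ√- t → ℤ√- t
(a + b √-) ⊕ (c + d √-) = (a + c) + (b + d) √-

_⊗_ : ∀ {t} → ℤ√- t → ℤ√- t → ℤ√- t
_⊗_ {t} (a + b √-) (c + d √-) = (a * c - (+ t) * (b * d)) + (a * d + b * c) √-

ι : ∀ {t} → ℤ → ℤ√- t
ι n = n + 0ℤ √-

zero√ : ∀ {t} → ℤ√- t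
zero√ = ι 0ℤ

IsSquare : ∀ {t} → ℤ√- t → Set
IsSquare {t} x = ∃ λ (k : ℤ√- t) → k ⊗ k ≡ x

DPair : ∀ {t} → ℤ√- t → ℤ√- t → ℤ√- t → Set
DPair n x y = IsSquare ((x ⊗ y) ⊕ n)

IsDTriple : ∀ {t} → ℤ√- t → ℤ√- t → ℤ√- t → ℤ√- t → Set
IsDTriple n a b c =
  (¬ a ≡ zero√) × (¬ b ≡ zero√) × (¬ c ≡ zero√) ×
  (¬ a ≡ b) × (¬ a ≡ c) × (¬ b ≡ c) ×
  DPair n a b × DPair n a c × DPair n b c

InZ : ∀ {t} → ℤ√- t → Set
InZ x = im x ≡ 0ℤ

-- Write c = x + y√-t and suppose y ≠ 0. From b - 1 = r², c - 1 = (u + v√-t)² and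
-- bc - 1 = (s + w√-t)² one gets sw = buv, and the integers P = s² - bu², R = bv² - w²
-- satisfy P + tR = b - 1 and s²R = bv²P; so P and R are positive and b ∣ PR. For
-- b = 2p⁴ this forces P = p⁴ or R = p⁴, and then s = p²z with z² - 2u² = 1, or w = p²z
-- with z² - 2v² = -1, and in both cases p ∣ z. But also r² - 2(p²)² = -1. In ℤ[√2] both
-- r + p²√2 and z + u√2 (resp. z + v√2) are powers of ε = 1 + √2, the first an odd one,
-- so a common power of them is congruent modulo p both to an integer and to an integer
-- multiple of √2, which is impossible for an element of norm ±1.
module Submission where

module PellEquation where

  open import Algebra.Bundles using (CommutativeMonoid)
  open import Data.List.Base using (_∷_; [])
  open import Data.Nat.Base
  open import Data.Nat.Divisibility
  open import Data.Nat.Induction using (<-rec)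
  open import Data.Nat.Properties
  open import Data.Nat.Tactic.RingSolver using (solve)
  open import Data.Product.Base using (_×_; _,_; ∃; ∃₂; proj₁; proj₂)
  open import Data.Sum.Base using (_⊎_; inj₁; inj₂)
  open import Function.Base using (_∋_)
  open import Function.Bundles using (_⇔_; mk⇔; Equivalence)
  open import Relation.Binary.PropositionalEquality
  open import Relation.Binary.PropositionalEquality.Algebra using (isMagma)
  open import Relation.Nullary.Negation using (contradiction)

  open Equivalence using (to; from)

  ≡+1⇔≡+1 : ∀ {x u y v} → x + u ≡ y + v → (u ≡ v + 1 ⇔ y ≡ x + 1)
  ≡+1⇔≡+1 {x} {u} {y} {v} x+u≡y+v = mk⇔
    (λ u≡v+1 → +-cancelʳ-≡ v y (x + 1) (begin
      y + v       ≡⟨ x+u≡y+v ⟨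
      x + u       ≡⟨ cong (x +_) u≡v+1 ⟩
      x + (v + 1) ≡⟨ solve (x ∷ v ∷ []) ⟩
      x + 1 + v   ∎))
    (λ y≡x+1 → +-cancelˡ-≡ x u (v + 1) (begin
      x + u       ≡⟨ x+u≡y+v ⟩
      y + v       ≡⟨ cong (_+ v) y≡x+1 ⟩
      x + 1 + v   ≡⟨ solve (x ∷ v ∷ []) ⟩
      x + (v + 1) ∎))
    where open ≡-Reasoning

  *-self-reflect-≤ : ∀ {m n} → m * m ≤ n * n → m ≤ n
  *-self-reflect-≤ m²≤n² = ≮⇒≥ (λ n<m → <⇒≱ (*-mono-< n<m n<m) m²≤n²)

  *-self-reflect-< : ∀ {m n} → m * m < n * n → m < n
  *-self-reflect-< m²<n² = ≰⇒> (λ n≤m → <⇒≱ m²<n² (*-mono-≤ n≤m n≤m))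

  m+n<2m⇒n<m : ∀ {m n} → m + n < 2 * m → n < m
  m+n<2m⇒n<m {m} {n} m+n<2m =
    +-cancelˡ-< m n m (subst (m + n <_) (cong (m +_) (+-identityʳ m)) m+n<2m)

  ℕ[√2] : Set
  ℕ[√2] = ℕ × ℕ

  open import Algebra.Definitions (_≡_ {A = ℕ[√2]}) using (Associative; Commutative; LeftIdentity)
  open import Algebra.Structures.Biased (_≡_ {A = ℕ[√2]}) using (isCommutativeMonoidˡ)

  infixl 7 _·_
  _·_ : ℕ[√2] → ℕ[√2] → ℕ[√2]
  (a , b) · (c , d) = a * c + 2 * (b * d) , a * d + b * c

  ·-assoc : Associative _·_
  ·-assoc (a , b) (c , d) (e , f) = cong₂ _,_
    ((a * c + 2 * (b * d)) * e + 2 * ((a * d + b * c) * f)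
       ≡ a * (c * e + 2 * (d * f)) + 2 * (b * (c * f + d * e))
       ∋ solve (a ∷ b ∷ c ∷ d ∷ e ∷ f ∷ []))
    ((a * c + 2 * (b * d)) * f + (a * d + b * c) * e
       ≡ a * (c * f + d * e) + b * (c * e + 2 * (d * f))
       ∋ solve (a ∷ b ∷ c ∷ d ∷ e ∷ f ∷ []))

  ·-comm : Commutative _·_
  ·-comm (a , b) (c , d) = cong₂ _,_
    (a * c + 2 * (b * d) ≡ c * a + 2 * (d * b) ∋ solve (a ∷ b ∷ c ∷ d ∷ []))
    (a * d + b * c ≡ c * b + d * a ∋ solve (a ∷ b ∷ c ∷ d ∷ []))

  ·-identityˡ : LeftIdentity (1 , 0) _·_
  ·-identityˡ (a , b) = cong₂ _,_
    (1 * a + 2 * (0 * b) ≡ a ∋ solve (a ∷ b ∷ []))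
    (1 * b + 0 * a ≡ b ∋ solve (a ∷ b ∷ []))

  ·-commutativeMonoid : CommutativeMonoid _ _
  ·-commutativeMonoid = record
    { _∙_ = _·_
    ; ε   = 1 , 0
    ; isCommutativeMonoid = isCommutativeMonoidˡ record
      { isSemigroup = record { isMagma = isMagma _·_ ; assoc = ·-assoc }
      ; identityˡ   = ·-identityˡ
      ; comm        = ·-comm
      }
    }

  -- n ⊛ x is the monoid multiple n × x in the multiplicative monoid, i.e. the power xⁿ.
  open import Algebra.Properties.CommutativeMonoid.Mult ·-commutativeMonoid
    using (×-homo-+; ×-assocˡ; ×-distrib-+) renaming (_×_ to _⊛_)

  ε : ℕ[√2]
  ε = 1 , 1

  ε·-≡ : ∀ a b → ε · (a , b) ≡ (a + 2 * b , a + b)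
  ε·-≡ a b = cong₂ _,_
    (1 * a + 2 * (1 * b) ≡ a + 2 * b ∋ solve (a ∷ b ∷ []))
    (1 * b + 1 * a ≡ a + b ∋ solve (a ∷ b ∷ []))

  Pell⁺ Pell⁻ Pell± : ℕ[√2] → Set
  Pell⁺ (a , b) = a * a ≡ 2 * (b * b) + 1
  Pell⁻ (a , b) = 2 * (b * b) ≡ a * a + 1
  Pell± x = Pell⁺ x ⊎ Pell⁻ x

  ε-norm-identity : ∀ a b → (a + 2 * b) * (a + 2 * b) + a * a ≡ 2 * ((a + b) * (a + b)) + 2 * (b * b)
  ε-norm-identity a b = solve (a ∷ b ∷ [])

  Pell⁺⇔Pell⁻-ε· : ∀ x → Pell⁺ x ⇔ Pell⁻ (ε · x)
  Pell⁺⇔Pell⁻-ε· (a , b) = subst (λ y → Pell⁺ (a , b) ⇔ Pell⁻ y) (sym (ε·-≡ a b))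
    (≡+1⇔≡+1 (ε-norm-identity a b))

  Pell⁻⇔Pell⁺-ε· : ∀ x → Pell⁻ x ⇔ Pell⁺ (ε · x)
  Pell⁻⇔Pell⁺-ε· (a , b) = subst (λ y → Pell⁻ (a , b) ⇔ Pell⁺ y) (sym (ε·-≡ a b))
    (≡+1⇔≡+1 (sym (ε-norm-identity a b)))

  Pell±-ε· : ∀ x → Pell± x → Pell± (ε · x)
  Pell±-ε· x (inj₁ pell⁺) = inj₂ (to (Pell⁺⇔Pell⁻-ε· x) pell⁺)
  Pell±-ε· x (inj₂ pell⁻) = inj₁ (to (Pell⁻⇔Pell⁺-ε· x) pell⁻)

  Pell±-ε-power : ∀ n → Pell± (n ⊛ ε)
  Pell±-ε-power zero    = inj₁ refl
  Pell±-ε-power (suc n) = Pell±-ε· (n ⊛ ε) (Pell±-ε-power n)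

  Pell±⇒b≤a : ∀ {a b} → Pell± (a , b) → b ≤ a
  Pell±⇒b≤a {a} {b} (inj₁ a²≡2b²+1) = *-self-reflect-≤ (begin
    b * b           ≤⟨ m≤m+n (b * b) (b * b + 0) ⟩
    2 * (b * b)     ≤⟨ m≤m+n (2 * (b * b)) 1 ⟩
    2 * (b * b) + 1 ≡⟨ a²≡2b²+1 ⟨
    a * a           ∎)
    where open ≤-Reasoning
  Pell±⇒b≤a {a} {zero}      (inj₂ _)        = z≤n
  Pell±⇒b≤a {a} {b@(suc _)} (inj₂ 2b²≡a²+1) = *-self-reflect-≤ (+-cancelʳ-≤ 1 (b * b) (a * a) (begin
    b * b + 1     ≤⟨ +-monoʳ-≤ (b * b) (s≤s z≤n) ⟩
    b * b + b * b ≡⟨ cong (b * b +_) (+-identityʳ (b * b)) ⟨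
    2 * (b * b)   ≡⟨ 2b²≡a²+1 ⟩
    a * a + 1     ∎))
    where open ≤-Reasoning

  Pell±⇒a<2b : ∀ {a b} → Pell± (a , b) → 0 < b → a < 2 * b
  Pell±⇒a<2b {a} {b} pell b>0 = *-self-reflect-< (begin-strict
    a * a                     <⟨ bound pell ⟩
    2 * (b * b) + 2 * (b * b) ≡⟨ solve (b ∷ []) ⟩
    2 * b * (2 * b)           ∎)
    where
    open ≤-Reasoning
    bound : Pell± (a , b) → a * a < 2 * (b * b) + 2 * (b * b)
    bound (inj₁ a²≡2b²+1) = begin-strict
      a * a                     ≡⟨ a²≡2b²+1 ⟩
      2 * (b * b) + 1           <⟨ +-monoʳ-< (2 * (b * b)) (*-monoʳ-≤ 2 (*-mono-≤ b>0 b>0)) ⟩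
      2 * (b * b) + 2 * (b * b) ∎
    bound (inj₂ 2b²≡a²+1) = begin-strict
      a * a                     <⟨ m<m+n (a * a) (s≤s z≤n) ⟩
      a * a + 1                 ≡⟨ 2b²≡a²+1 ⟨
      2 * (b * b)               ≤⟨ m≤m+n (2 * (b * b)) (2 * (b * b)) ⟩
      2 * (b * b) + 2 * (b * b) ∎

  ε-divisible : ∀ {a b} → b ≤ a → a < 2 * b → ∃₂ λ a′ b′ → ε · (a′ , b′) ≡ (a , b) × b′ < b
  ε-divisible {b = b} b≤a a<2b
    with b′ , refl     ← m≤n⇒∃[o]m+o≡n b≤a
    with b′<b          ← m+n<2m⇒n<m a<2b
    with a′ , b′+a′≡b ← m≤n⇒∃[o]m+o≡n (<⇒≤ b′<b)
    = a′ , b′ , ε·a′b′≡ , b′<b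
    where
    ε·a′b′≡ : ε · (a′ , b′) ≡ (b + b′ , b)
    ε·a′b′≡ = trans (ε·-≡ a′ b′) (cong₂ _,_
      (trans (a′ + 2 * b′ ≡ b′ + a′ + b′ ∋ solve (a′ ∷ b′ ∷ [])) (cong (_+ b′) b′+a′≡b))
      (trans (+-comm a′ b′) b′+a′≡b))

  EvenPower OddPower : ℕ[√2] → Set
  EvenPower x = ∃ λ k → (k + k) ⊛ ε ≡ x
  OddPower  x = ∃ λ k → suc (k + k) ⊛ ε ≡ x

  SolutionsAreεPowers : ℕ → Set
  SolutionsAreεPowers b =
    ∀ {a} → (Pell⁺ (a , b) → EvenPower (a , b)) × (Pell⁻ (a , b) → OddPower (a , b))

  -- A solution with b > 0 is ε times a solution of the opposite sign with smaller b.
  pell-descent : ∀ b → SolutionsAreεPowers b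
  pell-descent = <-rec SolutionsAreεPowers step
    where
    a*a≡1⇒a≡1 : ∀ a → a * a ≡ 1 → a ≡ 1
    a*a≡1⇒a≡1 1             _ = refl
    a*a≡1⇒a≡1 0             ()
    a*a≡1⇒a≡1 (suc (suc _)) ()

    step : ∀ b → (∀ {b′} → b′ < b → SolutionsAreεPowers b′) → SolutionsAreεPowers b
    step zero _ {a} =
        (λ a²≡1 → 0 , cong (_, 0) (sym (a*a≡1⇒a≡1 a a²≡1)))
      , (λ 0≡a²+1 → contradiction (trans 0≡a²+1 (+-comm (a * a) 1)) λ ())
    step b@(suc _) descend {a} = even , odd
      where
      even : Pell⁺ (a , b) → EvenPower (a , b)
      even pell⁺
        with a′ , b′ , ε·a′b′≡ab , b′<b ←
             ε-divisible (Pell±⇒b≤a (inj₁ pell⁺)) (Pell±⇒a<2b (inj₁ pell⁺) (s≤s z≤n))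
        with k , odd-k ← proj₂ (descend b′<b)
             (from (Pell⁻⇔Pell⁺-ε· (a′ , b′)) (subst Pell⁺ (sym ε·a′b′≡ab) pell⁺))
        = suc k , trans (cong (λ n → suc n ⊛ ε) (+-suc k k)) (trans (cong (ε ·_) odd-k) ε·a′b′≡ab)
      odd : Pell⁻ (a , b) → OddPower (a , b)
      odd pell⁻
        with a′ , b′ , ε·a′b′≡ab , b′<b ←
             ε-divisible (Pell±⇒b≤a (inj₂ pell⁻)) (Pell±⇒a<2b (inj₂ pell⁻) (s≤s z≤n))
        with k , even-k ← proj₁ (descend b′<b)
             (from (Pell⁺⇔Pell⁻-ε· (a′ , b′)) (subst Pell⁻ (sym ε·a′b′≡ab) pell⁻))
        = k , trans (cong (ε ·_) even-k) ε·a′b′≡ab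

  Pell±⇒ε-power : ∀ x → Pell± x → ∃ λ n → n ⊛ ε ≡ x
  Pell±⇒ε-power (_ , b) (inj₁ pell⁺) with k , even-k ← proj₁ (pell-descent b) pell⁺ = k + k       , even-k
  Pell±⇒ε-power (_ , b) (inj₂ pell⁻) with k , odd-k  ← proj₂ (pell-descent b) pell⁻ = suc (k + k) , odd-k

  -- x is congruent modulo p to an integer, resp. to an integer multiple of √2.
  Rational Surd : ℕ → ℕ[√2] → Set
  Rational p (_ , b) = p ∣ b
  Surd     p (a , _) = p ∣ a

  module _ {p : ℕ} where

    Rational-· : ∀ x y → Rational p x → Rational p y → Rational p (x · y)
    Rational-· (a , _) (c , _) p∣b p∣d = ∣m∣n⇒∣m+n (∣n⇒∣m*n a p∣d) (∣m⇒∣m*n c p∣b)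

    Surd-·-Surd : ∀ x y → Surd p x → Surd p y → Rational p (x · y)
    Surd-·-Surd (_ , b) (_ , d) p∣a p∣c = ∣m∣n⇒∣m+n (∣m⇒∣m*n d p∣a) (∣n⇒∣m*n b p∣c)

    Surd-·-Rational : ∀ x y → Surd p x → Rational p y → Surd p (x · y)
    Surd-·-Rational (_ , b) (c , _) p∣a p∣d = ∣m∣n⇒∣m+n (∣m⇒∣m*n c p∣a) (∣n⇒∣m*n 2 (∣n⇒∣m*n b p∣d))

    Rational-⊛ : ∀ x n → Rational p x → Rational p (n ⊛ x)
    Rational-⊛ x zero    _     = p ∣0
    Rational-⊛ x (suc n) rat-x = Rational-· x (n ⊛ x) rat-x (Rational-⊛ x n rat-x)

    Surd-odd-⊛ : ∀ x m → Surd p x → Surd p (suc (m + m) ⊛ x)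
    Surd-odd-⊛ x m surd-x = Surd-·-Rational x ((m + m) ⊛ x) surd-x
      (subst (Rational p) (trans (×-distrib-+ x x m) (sym (×-homo-+ x m m)))
        (Rational-⊛ (x · x) m (Surd-·-Surd x x surd-x surd-x)))

    Pell±∧Rational∧Surd⇒∣1 : ∀ x → Pell± x → Rational p x → Surd p x → p ∣ 1
    Pell±∧Rational∧Surd⇒∣1 (a , b) (inj₁ a²≡2b²+1) p∣b p∣a =
      ∣m+n∣m⇒∣n (subst (p ∣_) a²≡2b²+1 (∣m⇒∣m*n a p∣a)) (∣n⇒∣m*n 2 (∣m⇒∣m*n b p∣b))
    Pell±∧Rational∧Surd⇒∣1 (a , b) (inj₂ 2b²≡a²+1) p∣b p∣a =
      ∣m+n∣m⇒∣n (subst (p ∣_) 2b²≡a²+1 (∣n⇒∣m*n 2 (∣m⇒∣m*n b p∣b))) (∣m⇒∣m*n a p∣a)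

    -- With x = εⁿ, n odd, and y = εʲ, the element xʲ = yⁿ is both rational and a surd mod p.
    pell-obstruction : ∀ x y → Pell⁻ x → Rational p x → Pell± y → Surd p y → p ∣ 1
    pell-obstruction x@(_ , b) y pell⁻-x rat-x pell-y surd-y
      with m , n⊛ε≡x ← proj₂ (pell-descent b) pell⁻-x
      with j , j⊛ε≡y ← Pell±⇒ε-power y pell-y
      = Pell±∧Rational∧Surd⇒∣1 (j ⊛ x)
          (subst Pell± (sym j⊛x≡jn⊛ε) (Pell±-ε-power (j * suc (m + m))))
          (Rational-⊛ x j rat-x)
          (subst (Surd p) (sym j⊛x≡n⊛y) (Surd-odd-⊛ y m surd-y))
      where
      n : ℕ
      n = suc (m + m)
      j⊛x≡jn⊛ε : j ⊛ x ≡ (j * n) ⊛ ε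
      j⊛x≡jn⊛ε = trans (cong (j ⊛_) (sym n⊛ε≡x)) (×-assocˡ ε j n)
      j⊛x≡n⊛y : j ⊛ x ≡ n ⊛ y
      j⊛x≡n⊛y = trans j⊛x≡jn⊛ε (trans (cong (_⊛ ε) (*-comm j n))
        (trans (sym (×-assocˡ ε n j)) (cong (n ⊛_) j⊛ε≡y)))

module NormSystems where

  open import Data.Empty using (⊥)
  open import Data.List.Base using (_∷_; [])
  open import Data.Nat.Base
  open import Data.Nat.Divisibility
  open import Data.Nat.Primality using (Prime; prime⇒nonZero; prime⇒nonTrivial; euclidsLemma)
  open import Data.Nat.Properties
  open import Data.Nat.Tactic.RingSolver using (solve)
  open import Data.Product.Base using (_×_; _,_; ∃; proj₁; proj₂)
  open import Data.Sum.Base using (inj₁; inj₂; [_,_]′)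
  open import Function.Base using (id; _∋_)
  open import Relation.Binary.PropositionalEquality
  open import Relation.Nullary using (¬_; yes; no)
  open import Relation.Nullary.Negation using (contradiction)

  open PellEquation using (Pell⁺; Pell⁻; Pell±; Surd; pell-obstruction)

  -- For c = x + y√-t with y ≠ 0, c - 1 = (u + v√-t)² and bc - 1 = (s + w√-t)²:
  -- S, W, U, V are |s|, |w|, |u|, |v|, and P = s² - bu², R = bv² - w².
  record NormSystem (t b : ℕ) : Set where
    field
      P R S W U V : ℕ
      P>0      : 0 < P
      R>0      : 0 < R
      P+tR+1≡b : P + t * R + 1 ≡ b
      S²≡P+bU² : S * S ≡ P + b * (U * U)
      W²+R≡bV² : W * W + R ≡ b * (V * V)
      S²R≡bV²P : S * S * R ≡ b * (V * V) * P
      W²P≡bU²R : W * W * P ≡ b * (U * U) * R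

    b∣PR : b ∣ P * R
    b∣PR = ∣m+n∣m⇒∣n (subst (b ∣_) bV²P≡bU²R+PR (∣m⇒∣m*n P (m∣m*n (V * V))))
      (∣m⇒∣m*n R (m∣m*n (U * U)))
      where
      bV²P≡bU²R+PR : b * (V * V) * P ≡ b * (U * U) * R + P * R
      bV²P≡bU²R+PR = begin
        b * (V * V) * P       ≡⟨ S²R≡bV²P ⟨
        S * S * R             ≡⟨ cong (_* R) S²≡P+bU² ⟩
        (P + b * (U * U)) * R ≡⟨ *-distribʳ-+ R P (b * (U * U)) ⟩
        P * R + b * (U * U) * R ≡⟨ +-comm (P * R) _ ⟩
        b * (U * U) * R + P * R ∎
        where open ≡-Reasoning

  <⇒∃[o]m+o≡n : ∀ {m n} → m < n → ∃ λ o → 0 < o × m + o ≡ n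
  <⇒∃[o]m+o≡n {m} m<n with o , 1+m+o≡n ← m≤n⇒∃[o]m+o≡n m<n = suc o , z<s , trans (+-suc m o) 1+m+o≡n

  *-≤-transfer : ∀ {a b c d} → 0 < a → a * d ≡ b * c → a ≤ b → c ≤ d
  *-≤-transfer {a} {b} {c} {d} a>0 ad≡bc a≤b =
    *-cancelˡ-≤ a {{>-nonZero a>0}} (≤-trans (*-monoˡ-≤ c a≤b) (≤-reflexive (sym ad≡bc)))

  -- α = s², β = bu², γ = bv², δ = w²: αδ = βγ forces α - β and γ - δ to have the same sign.
  positive-differences : ∀ {b t α β γ δ} → 2 ≤ b → 0 < α → 0 < γ →
    α + t * γ + 1 ≡ b + t * δ + β → α * δ ≡ β * γ → β < α × δ < γ
  positive-differences {b} {t} {α} {β} {γ} {δ} 2≤b α>0 γ>0 balance αδ≡βγ =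
      ≰⇒> (λ α≤β → not-both α≤β (*-≤-transfer α>0 αδ≡βγ α≤β))
    , ≰⇒> (λ γ≤δ → not-both (*-≤-transfer γ>0 γβ≡δα γ≤δ) γ≤δ)
    where
    γβ≡δα : γ * β ≡ δ * α
    γβ≡δα = trans (*-comm γ β) (trans (sym αδ≡βγ) (*-comm α δ))
    not-both : α ≤ β → γ ≤ δ → ⊥
    not-both α≤β γ≤δ = contradiction (≤-trans 2≤b (+-cancelʳ-≤ (β + t * δ) b 1 (begin
      b + (β + t * δ)   ≡⟨ solve (b ∷ β ∷ t ∷ δ ∷ []) ⟩
      b + t * δ + β     ≡⟨ balance ⟨
      α + t * γ + 1     ≤⟨ +-monoˡ-≤ 1 (+-mono-≤ α≤β (*-monoʳ-≤ t γ≤δ)) ⟩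
      β + t * δ + 1     ≡⟨ +-comm (β + t * δ) 1 ⟩
      1 + (β + t * δ)   ∎))) λ { (s≤s ()) }
      where open ≤-Reasoning

  balance⇒P+tR+1≡b : ∀ {b t α β γ δ P R} → β + P ≡ α → δ + R ≡ γ →
    α + t * γ + 1 ≡ b + t * δ + β → P + t * R + 1 ≡ b
  balance⇒P+tR+1≡b {b} {t} {α} {β} {γ} {δ} {P} {R} β+P≡α δ+R≡γ balance =
    +-cancelˡ-≡ (β + t * δ) (P + t * R + 1) b (begin
      β + t * δ + (P + t * R + 1) ≡⟨ solve (β ∷ t ∷ δ ∷ P ∷ R ∷ []) ⟩
      β + P + t * (δ + R) + 1     ≡⟨ cong₂ (λ α γ → α + t * γ + 1) β+P≡α δ+R≡γ ⟩
      α + t * γ + 1               ≡⟨ balance ⟩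
      b + t * δ + β               ≡⟨ solve (b ∷ t ∷ δ ∷ β ∷ []) ⟩
      β + t * δ + b               ∎)
    where open ≡-Reasoning

  cross-products : ∀ {α β γ δ P R} → β + P ≡ α → δ + R ≡ γ → α * δ ≡ β * γ →
    α * R ≡ γ * P × δ * P ≡ β * R
  cross-products {α} {β} {γ} {δ} {P} {R} β+P≡α δ+R≡γ αδ≡βγ =
      +-cancelˡ-≡ (α * δ) (α * R) (γ * P) (begin
        α * δ + α * R ≡⟨ *-distribˡ-+ α δ R ⟨
        α * (δ + R)   ≡⟨ cong (α *_) δ+R≡γ ⟩
        α * γ         ≡⟨ cong (_* γ) β+P≡α ⟨
        (β + P) * γ   ≡⟨ *-distribʳ-+ γ β P ⟩
        β * γ + P * γ ≡⟨ cong₂ _+_ αδ≡βγ (*-comm γ P) ⟨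
        α * δ + γ * P ∎)
    , +-cancelˡ-≡ (β * δ) (δ * P) (β * R) (begin
        β * δ + δ * P ≡⟨ solve (β ∷ δ ∷ P ∷ []) ⟩
        δ * (β + P)   ≡⟨ cong (δ *_) β+P≡α ⟩
        δ * α         ≡⟨ *-comm δ α ⟩
        α * δ         ≡⟨ αδ≡βγ ⟩
        β * γ         ≡⟨ cong (β *_) δ+R≡γ ⟨
        β * (δ + R)   ≡⟨ *-distribˡ-+ β δ R ⟩
        β * δ + β * R ∎)
    where open ≡-Reasoning

  squares⇒NormSystem : ∀ {t b S U V W} → 2 ≤ b → 0 < S → 0 < V →
    S * S + t * (b * (V * V)) + 1 ≡ b + t * (W * W) + b * (U * U) → S * W ≡ b * (U * V) →
    NormSystem t b
  squares⇒NormSystem {t} {b} {S} {U} {V} {W} 2≤b S>0 V>0 balance SW≡bUV =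
    system (positive-differences {b} {t} {S * S} {b * (U * U)} {b * (V * V)} {W * W} 2≤b
      (*-mono-< S>0 S>0) (*-mono-< (≤-trans (s≤s z≤n) 2≤b) (*-mono-< V>0 V>0))
      balance S²W²≡bU²bV²)
    where
    S²W²≡bU²bV² : S * S * (W * W) ≡ b * (U * U) * (b * (V * V))
    S²W²≡bU²bV² = begin
      S * S * (W * W)             ≡⟨ solve (S ∷ W ∷ []) ⟩
      S * W * (S * W)             ≡⟨ cong (λ x → x * x) SW≡bUV ⟩
      b * (U * V) * (b * (U * V)) ≡⟨ solve (b ∷ U ∷ V ∷ []) ⟩
      b * (U * U) * (b * (V * V)) ∎
      where open ≡-Reasoning

    system : b * (U * U) < S * S × W * W < b * (V * V) → NormSystem t b
    system (bU²<S² , W²<bV²)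
      with P , P>0 , bU²+P≡S² ← <⇒∃[o]m+o≡n bU²<S²
      with R , R>0 , W²+R≡bV² ← <⇒∃[o]m+o≡n W²<bV²
      = record
        { P = P ; R = R ; S = S ; W = W ; U = U ; V = V
        ; P>0      = P>0
        ; R>0      = R>0
        ; P+tR+1≡b = balance⇒P+tR+1≡b {b} {t} bU²+P≡S² W²+R≡bV² balance
        ; S²≡P+bU² = trans (sym bU²+P≡S²) (+-comm (b * (U * U)) P)
        ; W²+R≡bV² = W²+R≡bV²
        ; S²R≡bV²P = proj₁ (cross-products {S * S} {b * (U * U)} bU²+P≡S² W²+R≡bV² S²W²≡bU²bV²)
        ; W²P≡bU²R = proj₂ (cross-products {S * S} {b * (U * U)} bU²+P≡S² W²+R≡bV² S²W²≡bU²bV²)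
        }

  m∣n<2m⇒n≡m : ∀ {m n} → 0 < n → m ∣ n → n < 2 * m → n ≡ m
  m∣n<2m⇒n≡m     n>0 (divides 0 refl)             _     = contradiction n>0 (<-irrefl refl)
  m∣n<2m⇒n≡m {m} _   (divides 1 refl)             _     = +-identityʳ m
  m∣n<2m⇒n≡m {m} _   (divides (suc (suc _)) refl) n<2m =
    contradiction n<2m (≤⇒≯ (+-monoʳ-≤ m (+-monoʳ-≤ m z≤n)))

  module _ {p : ℕ} (p-prime : Prime p) where

    private instance
      p≢0 : NonZero p
      p≢0 = prime⇒nonZero p-prime
      p²≢0 : NonZero (p * p)
      p²≢0 = m*n≢0 p p
      p⁴≢0 : NonZero (p ^ 4)
      p⁴≢0 = m^n≢0 p 4

    p∤1 : ¬ p ∣ 1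
    p∤1 p∣1 = nonTrivial⇒≢1 {{prime⇒nonTrivial p-prime}} (∣1⇒≡1 p∣1)

    p∣m*m⇒p∣m : ∀ {m} → p ∣ m * m → p ∣ m
    p∣m*m⇒p∣m {m} p∣m² = [ id , id ]′ (euclidsLemma m m p-prime p∣m²)

    p∣p⁴ : p ∣ p ^ 4
    p∣p⁴ = m∣m*n (p ^ 3)

    ^-∣-cancelʳ : ∀ k {m n} → ¬ p ∣ n → p ^ k ∣ m * n → p ^ k ∣ m
    ^-∣-cancelʳ zero    {m}     _   _        = 1∣ m
    ^-∣-cancelʳ (suc k) {m} {n} p∤n pᵏ⁺¹∣mn
      with euclidsLemma m n p-prime (∣-trans (m∣m*n (p ^ k)) pᵏ⁺¹∣mn)
    ... | inj₂ p∣n             = contradiction p∣n p∤n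
    ... | inj₁ (divides q refl) = subst (p ^ suc k ∣_) (*-comm p q)
      (*-monoʳ-∣ p (^-∣-cancelʳ k p∤n (*-cancelˡ-∣ p
        (subst (p ^ suc k ∣_) (q * p * n ≡ p * (q * n) ∋ solve (q ∷ p ∷ n ∷ [])) pᵏ⁺¹∣mn))))

    square-cancel : ∀ {n c d} → n * n + p * p * c ≡ p * p * d → ∃ λ m → n ≡ p * m × m * m + c ≡ d
    square-cancel {n} {c} {d} n²+p²c≡p²d = cancel (p∣m*m⇒p∣m p∣n²) n²+p²c≡p²d
      where
      p∣n² : p ∣ n * n
      p∣n² = ∣m+n∣m⇒∣n
        (subst (p ∣_) (trans (sym n²+p²c≡p²d) (+-comm (n * n) (p * p * c))) (∣m⇒∣m*n d (m∣m*n p)))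
        (∣m⇒∣m*n c (m∣m*n p))
      cancel : ∀ {n} → p ∣ n → n * n + p * p * c ≡ p * p * d → ∃ λ m → n ≡ p * m × m * m + c ≡ d
      cancel (divides m refl) m²p²+p²c≡p²d = m , *-comm m p , *-cancelˡ-≡ (m * m + c) d (p * p)
        (trans (p * p * (m * m + c) ≡ m * p * (m * p) + p * p * c ∋ solve (m ∷ p ∷ c ∷ [])) m²p²+p²c≡p²d)

    p⁴≡p²p² : p ^ 4 ≡ p * p * (p * p)
    p⁴≡p²p² = p * (p * (p * (p * 1))) ≡ p * p * (p * p) ∋ solve (p ∷ [])

    square-cancel⁴ : ∀ {n c d} → n * n + p ^ 4 * c ≡ p ^ 4 * d → ∃ λ z → n ≡ p * (p * z) × z * z + c ≡ d
    square-cancel⁴ {n} {c} {d} n²+p⁴c≡p⁴d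
      with m , n≡pm , m²+p²c≡p²d ← square-cancel (subst₂ (λ x y → n * n + x ≡ y)
             (trans (cong (_* c) p⁴≡p²p²) (*-assoc (p * p) (p * p) c))
             (trans (cong (_* d) p⁴≡p²p²) (*-assoc (p * p) (p * p) d)) n²+p⁴c≡p⁴d)
      with z , m≡pz , z²+c≡d ← square-cancel m²+p²c≡p²d
      = z , trans n≡pm (cong (p *_) m≡pz) , z²+c≡d

    Pell⁺-root : ∀ {S U} → S * S ≡ p ^ 4 + 2 * p ^ 4 * (U * U) → ∃ λ z → S ≡ p * (p * z) × Pell⁺ (z , U)
    Pell⁺-root {S} {U} S²≡p⁴[2U²+1] =
      let z , S≡p²z , z²+0≡2U²+1 = square-cancel⁴ {S} {0} {2 * (U * U) + 1} (factor {p ^ 4} S²≡p⁴[2U²+1])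
      in  z , S≡p²z , trans (sym (+-identityʳ (z * z))) z²+0≡2U²+1
      where
      factor : ∀ {Q} → S * S ≡ Q + 2 * Q * (U * U) → S * S + Q * 0 ≡ Q * (2 * (U * U) + 1)
      factor {Q} S²≡ = trans (S * S + Q * 0 ≡ S * S ∋ solve (S ∷ Q ∷ []))
        (trans S²≡ (Q + 2 * Q * (U * U) ≡ Q * (2 * (U * U) + 1) ∋ solve (Q ∷ U ∷ [])))

    Pell⁻-root : ∀ {W V} → W * W + p ^ 4 ≡ 2 * p ^ 4 * (V * V) → ∃ λ z → W ≡ p * (p * z) × Pell⁻ (z , V)
    Pell⁻-root {W} {V} W²+p⁴≡2p⁴V² =
      let z , W≡p²z , z²+1≡2V² = square-cancel⁴ {W} {1} {2 * (V * V)} (factor {p ^ 4} W²+p⁴≡2p⁴V²)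
      in  z , W≡p²z , sym z²+1≡2V²
      where
      factor : ∀ {Q} → W * W + Q ≡ 2 * Q * (V * V) → W * W + Q * 1 ≡ Q * (2 * (V * V))
      factor {Q} W²+Q≡ = trans (cong (W * W +_) (*-identityʳ Q))
        (trans W²+Q≡ (2 * Q * (V * V) ≡ Q * (2 * (V * V)) ∋ solve (Q ∷ V ∷ [])))

    root-divisible : ∀ {S z y k} → S ≡ p * (p * z) → S * S * y ≡ 2 * p ^ 4 * k * p ^ 4 → ¬ p ∣ y → p ∣ z
    root-divisible {z = z} {y} {k} refl S²y≡2p⁴kp⁴ p∤y =
      [ p∣m*m⇒p∣m , (λ p∣y → contradiction p∣y p∤y) ]′ (euclidsLemma (z * z) y p-prime p∣z²y)
      where
      z²y≡2p⁴k : z * z * y ≡ 2 * p ^ 4 * k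
      z²y≡2p⁴k = *-cancelˡ-≡ (z * z * y) (2 * p ^ 4 * k) (p ^ 4)
        (trans (p * (p * (p * (p * 1))) * (z * z * y) ≡ p * (p * z) * (p * (p * z)) * y
                  ∋ solve (p ∷ z ∷ y ∷ []))
          (trans S²y≡2p⁴kp⁴ (*-comm (2 * p ^ 4 * k) (p ^ 4))))
      p∣z²y : p ∣ z * z * y
      p∣z²y = subst (p ∣_) (sym z²y≡2p⁴k) (∣m⇒∣m*n k (∣n⇒∣m*n 2 p∣p⁴))

    SurdUnit : Set
    SurdUnit = ∃ λ x → Pell± x × Surd p x

    surd-unit-if-p∤R : ∀ {t} (sys : NormSystem t (2 * p ^ 4)) → ¬ p ∣ NormSystem.R sys → SurdUnit
    surd-unit-if-p∤R {t} sys p∤R =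
      finish (Pell⁺-root {S} {U} (subst (λ P → S * S ≡ P + 2 * p ^ 4 * (U * U)) P≡p⁴ S²≡P+bU²))
      where
      open NormSystem sys
      P≡p⁴ : P ≡ p ^ 4
      P≡p⁴ = m∣n<2m⇒n≡m P>0 (^-∣-cancelʳ 4 p∤R (∣-trans (n∣m*n 2) b∣PR))
        (≤-<-trans (m≤m+n P (t * R)) (subst (P + t * R <_) P+tR+1≡b (m<m+n (P + t * R) z<s)))
      finish : (∃ λ z → S ≡ p * (p * z) × Pell⁺ (z , U)) → SurdUnit
      finish (z , S≡p²z , pell⁺) = (z , U) , inj₁ pell⁺ ,
        root-divisible S≡p²z (subst (λ P → S * S * R ≡ 2 * p ^ 4 * (V * V) * P) P≡p⁴ S²R≡bV²P) p∤R

    surd-unit-if-p∣R : ∀ {t} → 0 < t → (sys : NormSystem t (2 * p ^ 4)) → p ∣ NormSystem.R sys → SurdUnit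
    surd-unit-if-p∣R {t} t>0 sys p∣R =
      finish (Pell⁻-root {W} {V} (subst (λ R → W * W + R ≡ 2 * p ^ 4 * (V * V)) R≡p⁴ W²+R≡bV²))
      where
      open NormSystem sys
      p∤P : ¬ p ∣ P
      p∤P p∣P = p∤1 (∣m+n∣m⇒∣n (subst (p ∣_) (sym P+tR+1≡b) (∣n⇒∣m*n 2 p∣p⁴))
                                (∣m∣n⇒∣m+n p∣P (∣n⇒∣m*n t p∣R)))
      R≡p⁴ : R ≡ p ^ 4
      R≡p⁴ = m∣n<2m⇒n≡m R>0
        (^-∣-cancelʳ 4 p∤P (subst (p ^ 4 ∣_) (*-comm P R) (∣-trans (n∣m*n 2) b∣PR)))
        (≤-<-trans (≤-trans (m≤n*m R t {{>-nonZero t>0}}) (m≤n+m (t * R) P))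
                   (subst (P + t * R <_) P+tR+1≡b (m<m+n (P + t * R) z<s)))
      finish : (∃ λ z → W ≡ p * (p * z) × Pell⁻ (z , V)) → SurdUnit
      finish (z , W≡p²z , pell⁻) = (z , V) , inj₂ pell⁻ ,
        root-divisible W≡p²z (subst (λ R → W * W * P ≡ 2 * p ^ 4 * (U * U) * R) R≡p⁴ W²P≡bU²R) p∤P

    surd-unit : ∀ {t} → 0 < t → NormSystem t (2 * p ^ 4) → SurdUnit
    surd-unit t>0 sys with p ∣? NormSystem.R sys
    ... | yes p∣R = surd-unit-if-p∣R t>0 sys p∣R
    ... | no  p∤R = surd-unit-if-p∤R sys p∤R

    ¬NormSystem-2p⁴ : ∀ {t} → 0 < t → (∃ λ r → r * r + 1 ≡ 2 * p ^ 4) → ¬ NormSystem t (2 * p ^ 4)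
    ¬NormSystem-2p⁴ t>0 (r , r²+1≡2p⁴) sys =
      let x , pell-x , surd-x = surd-unit t>0 sys
      in p∤1 (pell-obstruction (r , p * p) x Pell⁻-r (m∣m*n p) pell-x surd-x)
      where
      Pell⁻-r : Pell⁻ (r , p * p)
      Pell⁻-r = trans (cong (2 *_) (sym p⁴≡p²p²)) (sym r²+1≡2p⁴)

module Coordinates where

  open import Data.Integer
  open import Data.Integer.Properties
  open import Data.Integer.Tactic.RingSolver using (solve)
  open import Data.List.Base using (_∷_; [])
  import Data.Nat as ℕ
  import Data.Nat.Properties as ℕ
  open import Data.Product.Base using (_×_; _,_; ∃; ∃₂)
  open import Data.Sum.Base using (inj₁; inj₂; [_,_]′)
  open import Function.Base using (_∘_; _∋_)
  open import Relation.Binary.PropositionalEquality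
  open import Relation.Nullary.Negation using (contradiction)

  open import Defs
  open NormSystems using (NormSystem; squares⇒NormSystem)

  square-abs : ∀ z → z * z ≡ + (∣ z ∣ ℕ.* ∣ z ∣)
  square-abs (+ n)    = sym (pos-* n n)
  square-abs -[1+ n ] = +◃n≡+n _

  +-*-square-abs : ∀ m z → + (m ℕ.* (∣ z ∣ ℕ.* ∣ z ∣)) ≡ + m * (z * z)
  +-*-square-abs m z = trans (pos-* m _) (cong (+ m *_) (sym (square-abs z)))

  abs-positive : ∀ {z} → z ≢ 0ℤ → 0 ℕ.< ∣ z ∣
  abs-positive z≢0 = ℕ.n≢0⇒n>0 (z≢0 ∘ ∣i∣≡0⇒i≡0)

  i*j+j*i≡0⇒i*j≡0 : ∀ {i j} → i * j + j * i ≡ 0ℤ → i * j ≡ 0ℤ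
  i*j+j*i≡0⇒i*j≡0 {i} {j} 2ij≡0 = *-cancelˡ-≡ (+ 2) (i * j) 0ℤ
    (trans (+ 2 * (i * j) ≡ i * j + j * i ∋ solve (i ∷ j ∷ [])) 2ij≡0)

  sw≡βuv : ∀ {s w u v β y} → s * w + w * s ≡ β * y → u * v + v * u ≡ 1ℤ * y → s * w ≡ β * (u * v)
  sw≡βuv {s} {w} {u} {v} {β} {y} 2sw≡βy 2uv≡y = *-cancelˡ-≡ (+ 2) (s * w) (β * (u * v)) (begin
    + 2 * (s * w)       ≡⟨ solve (s ∷ w ∷ []) ⟩
    s * w + w * s       ≡⟨ 2sw≡βy ⟩
    β * y               ≡⟨ solve (β ∷ y ∷ []) ⟩
    β * (1ℤ * y)        ≡⟨ cong (β *_) 2uv≡y ⟨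
    β * (u * v + v * u) ≡⟨ solve (β ∷ u ∷ v ∷ []) ⟩
    + 2 * (β * (u * v)) ∎)
    where open ≡-Reasoning

  real-balance : ∀ {s w u v β T x} →
    u * u - T * (v * v) ≡ 1ℤ * x - 1ℤ → s * s - T * (w * w) ≡ β * x - 1ℤ →
    s * s + T * (β * (v * v)) + 1ℤ ≡ β + T * (w * w) + β * (u * u)
  real-balance {s} {w} {u} {v} {β} {T} {x} u²-Tv²≡x-1 s²-Tw²≡βx-1 = begin
    s * s + T * (β * (v * v)) + 1ℤ
      ≡⟨ solve (s ∷ w ∷ u ∷ v ∷ β ∷ T ∷ []) ⟩
    β + T * (w * w) + β * (u * u) + ((s * s - T * (w * w)) - β * (u * u - T * (v * v)) - (β - 1ℤ))
      ≡⟨ cong₂ (λ σ μ → β + T * (w * w) + β * (u * u) + (σ - β * μ - (β - 1ℤ)))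
               s²-Tw²≡βx-1 u²-Tv²≡x-1 ⟩
    β + T * (w * w) + β * (u * u) + ((β * x - 1ℤ) - β * (1ℤ * x - 1ℤ) - (β - 1ℤ))
      ≡⟨ solve (w ∷ u ∷ β ∷ T ∷ x ∷ []) ⟩
    β + T * (w * w) + β * (u * u) ∎
    where open ≡-Reasoning

  module _ {t : ℕ.ℕ} where

    DPair-components : ∀ {n a x y} → DPair {t} (ι n) (ι a) (x + y √-) →
      ∃₂ λ e f → (e * e - + t * (f * f) ≡ a * x + n) × (e * f + f * e ≡ a * y)
    DPair-components {n} {a} {x} {y} (e + f √- , k²≡az+n) =
      e , f , trans (cong re k²≡az+n) (real {+ t}) , trans (cong im k²≡az+n) imaginary
      where
      real : ∀ {T} → a * x - T * (0ℤ * y) + n ≡ a * x + n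
      real {T} = solve (a ∷ x ∷ y ∷ n ∷ T ∷ [])
      imaginary : a * y + 0ℤ * x + 0ℤ ≡ a * y
      imaginary = solve (a ∷ x ∷ y ∷ [])

    b-1-square : ∀ {b} → 2 ℕ.≤ b → DPair {t} (ι (- 1ℤ)) (ι 1ℤ) (ι (+ b)) → ∃ λ r → r ℕ.* r ℕ.+ 1 ≡ b
    b-1-square {b} 2≤b pair
      with e , f , e²-tf²≡b-1 , 2ef≡0 ← DPair-components { - 1ℤ} {1ℤ} {+ b} {0ℤ} pair
      with i*j≡0⇒i≡0∨j≡0 e {f} (i*j+j*i≡0⇒i*j≡0 {e} 2ef≡0)
    ... | inj₂ refl =
      ∣ e ∣ , +-injective (trans (cong (_+ 1ℤ) (sym (square-abs e))) (rearrange {+ t} e²-tf²≡b-1))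
      where
      open ≡-Reasoning
      rearrange : ∀ {T β} → e * e - T * (0ℤ * 0ℤ) ≡ 1ℤ * β - 1ℤ → e * e + 1ℤ ≡ β
      rearrange {T} {β} e²≡β-1 = begin
        e * e + 1ℤ                                   ≡⟨ solve (e ∷ T ∷ β ∷ []) ⟩
        e * e - T * (0ℤ * 0ℤ) - (1ℤ * β - 1ℤ) + β   ≡⟨ cong (λ i → i - (1ℤ * β - 1ℤ) + β) e²≡β-1 ⟩
        1ℤ * β - 1ℤ - (1ℤ * β - 1ℤ) + β             ≡⟨ solve (β ∷ []) ⟩
        β                                            ∎
    ... | inj₁ refl =
      contradiction (ℕ.≤-trans 2≤b (ℕ.m+n≤o⇒m≤o b (ℕ.≤-reflexive b+tf²≡1))) λ { (ℕ.s≤s ()) }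
      where
      open ≡-Reasoning
      rearrange : ∀ {T β} → 0ℤ * 0ℤ - T * (f * f) ≡ 1ℤ * β - 1ℤ → β + T * (f * f) ≡ 1ℤ
      rearrange {T} {β} -Tf²≡β-1 = begin
        β + T * (f * f)                              ≡⟨ solve (β ∷ T ∷ f ∷ []) ⟩
        1ℤ * β - 1ℤ - (0ℤ * 0ℤ - T * (f * f)) + 1ℤ ≡⟨ cong (λ i → 1ℤ * β - 1ℤ - i + 1ℤ) -Tf²≡β-1 ⟩
        1ℤ * β - 1ℤ - (1ℤ * β - 1ℤ) + 1ℤ           ≡⟨ solve (β ∷ []) ⟩
        1ℤ                                           ∎
      b+tf²≡1 : b ℕ.+ t ℕ.* (∣ f ∣ ℕ.* ∣ f ∣) ≡ 1
      b+tf²≡1 = +-injective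
        (trans (cong (λ i → + b + i) (+-*-square-abs t f)) (rearrange {+ t} {+ b} e²-tf²≡b-1))

    non-integral-system : ∀ {b x y} → 2 ℕ.≤ b →
      DPair {t} (ι (- 1ℤ)) (ι 1ℤ) (x + y √-) → DPair {t} (ι (- 1ℤ)) (ι (+ b)) (x + y √-) →
      y ≢ 0ℤ → NormSystem t b
    non-integral-system {b} {x} {y} 2≤b pair₁ pair₂ y≢0
      with u , v , u²-tv²≡x-1 , 2uv≡y  ← DPair-components { - 1ℤ} {1ℤ} {x} {y} pair₁
      with s , w , s²-tw²≡bx-1 , 2sw≡by ← DPair-components { - 1ℤ} {+ b} {x} {y} pair₂
      = squares⇒NormSystem {t} {b} {∣ s ∣} {∣ u ∣} {∣ v ∣} {∣ w ∣}
          2≤b (abs-positive s≢0) (abs-positive v≢0) balance SW≡bUV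
      where
      v≢0 : v ≢ 0ℤ
      v≢0 refl = y≢0 (trans (sym (*-identityˡ y))
        (trans (sym 2uv≡y) (u * 0ℤ + 0ℤ * u ≡ 0ℤ ∋ solve (u ∷ []))))
      s≢0 : s ≢ 0ℤ
      s≢0 refl = [ (λ b≡0 → contradiction (subst (2 ℕ.≤_) (+-injective b≡0) 2≤b) λ ()) , y≢0 ]′
        (i*j≡0⇒i≡0∨j≡0 (+ b) (trans (sym 2sw≡by) (0ℤ * w + w * 0ℤ ≡ 0ℤ ∋ solve (w ∷ []))))
      balance : ∣ s ∣ ℕ.* ∣ s ∣ ℕ.+ t ℕ.* (b ℕ.* (∣ v ∣ ℕ.* ∣ v ∣)) ℕ.+ 1
              ≡ b ℕ.+ t ℕ.* (∣ w ∣ ℕ.* ∣ w ∣) ℕ.+ b ℕ.* (∣ u ∣ ℕ.* ∣ u ∣)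
      balance = +-injective (begin
        + (∣ s ∣ ℕ.* ∣ s ∣) + + (t ℕ.* (b ℕ.* (∣ v ∣ ℕ.* ∣ v ∣))) + 1ℤ
          ≡⟨ cong₂ (λ i j → i + j + 1ℤ) (sym (square-abs s))
                   (trans (pos-* t _) (cong (+ t *_) (+-*-square-abs b v))) ⟩
        s * s + + t * (+ b * (v * v)) + 1ℤ
          ≡⟨ real-balance {s} {w} {u} {v} {+ b} {+ t} u²-tv²≡x-1 s²-tw²≡bx-1 ⟩
        + b + + t * (w * w) + + b * (u * u)
          ≡⟨ cong₂ (λ i j → + b + i + j) (+-*-square-abs t w) (+-*-square-abs b u) ⟨
        + b + + (t ℕ.* (∣ w ∣ ℕ.* ∣ w ∣)) + + (b ℕ.* (∣ u ∣ ℕ.* ∣ u ∣)) ∎)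
        where open ≡-Reasoning
      SW≡bUV : ∣ s ∣ ℕ.* ∣ w ∣ ≡ b ℕ.* (∣ u ∣ ℕ.* ∣ v ∣)
      SW≡bUV = trans (sym (abs-* s w))
        (trans (cong ∣_∣ (sw≡βuv {s} {w} {u} {v} {+ b} 2sw≡by 2uv≡y))
        (trans (abs-* (+ b) (u * v)) (cong (b ℕ.*_) (abs-* u v))))

open import Data.Empty using (⊥-elim)
open import Data.Integer using (+_; -_; 1ℤ; 0ℤ; _≟_)
open import Data.Nat using (ℕ; _>_; _*_; _^_; _≤_)
open import Data.Nat.Primality using (Prime; prime⇒nonZero)
open import Data.Nat.Properties using (*-monoʳ-≤; m^n>0)
open import Data.Product.Base using (_,_)
open import Relation.Binary.PropositionalEquality using (_≢_)
open import Relation.Nullary using (yes; no)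

open import Defs

open Coordinates using (b-1-square; non-integral-system)
open NormSystems using (¬NormSystem-2p⁴)

theorem4 : (t : ℕ) → t > 0 → (p : ℕ) → Prime p → p ≢ 2 →
    (c : ℤ√- t) → IsDTriple (ι (- 1ℤ)) (ι 1ℤ) (ι (+ (2 * p ^ 4))) c → InZ c
theorem4 t t>0 p p-prime _ (x + y √-) (_ , _ , _ , _ , _ , _ , pair[1,b] , pair[1,c] , pair[b,c])
  with y ≟ 0ℤ
... | yes y≡0 = y≡0
... | no  y≢0 = ⊥-elim (¬NormSystem-2p⁴ p-prime t>0
                         (b-1-square 2≤b pair[1,b])
                         (non-integral-system 2≤b pair[1,c] pair[b,c] y≢0))
  where
  2≤b : 2 ≤ 2 * p ^ 4
  2≤b = *-monoʳ-≤ 2 (m^n>0 p {{prime⇒nonZero p-prime}} 4)
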